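{- Let $D$ be an $n\times n$ distance matrix, let $\mathbf{X}$ be an assignment of the variables $\{x_{i,n+1}:i\in[n]\}$ satisfying $\phi_1$, and let $D^{(2)}$ be the distance matrix of the $2$-skeleton of $D$. Then $D(\phi_1,\mathbf{X})=D^{(2)}$.
   Context: $[n]=\{1,\dots,n\}$. An $n\times n$ matrix $D$ with non-negative integer entries is a distance matrix if all diagonal entries are $0$, all off-diagonal entries are strictly positive, $D$ is symmetric, and $D_{iw}+D_{wj}\ge D_{ij}$ for all $i,j,w$. Let $G_D$ be the graph on $\{v_1,\dots,v_n\}$ with $\{v_i,v_j\}$ an edge iff $D_{ij}=1$, and $d_{G_D}$ its shortest-path distance. The 2-CNF formula $\phi_1$ has boolean variables $x_{i,n+1}$, $i\in[n]$, and is the conjunction of: for all $i,j\in[n]$ with $D_{ij}>2$, the clause $(\bar x_{i,n+1}\lor\bar x_{j,n+1})$; for all $i,j\in[n]$ with $D_{ij}=2$ and $d_{G_D}(v_i,v_j)>2$, the clauses $(x_{i,n+1}\lor x_{i,n+1})$ and $(x_{j,n+1}\lor x_{j,n+1})$. For a satisfying assignment $\mathbf{X}$, $G_{\phi_1,\mathbf{X}}$ is the graph on $\{v_1,\dots,v_{n+1}\}$ whose induced subgraph on $v_1,\dots,v_n$ is $G_D$ and in which $v_{n+1}$ is adjacent to $v_i$ iff $x_{i,n+1}$ is true; $D(\phi_1,\mathbf{X})$ is the $n\times n$ matrix of shortest-path distances in $G_{\phi_1,\mathbf{X}}$ between $v_1,\dots,v_n$ ($\infty$ if no path). The $2$-skeleton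 of $D$ is the edge-weighted graph on $[n]$ with an edge $\{i,j\}$ ($i<j$) iff $D_{ij}\le2$, of weight $D_{ij}$; $D^{(2)}_{ij}$ is the weighted shortest-path distance from $i$ to $j$ in it ($\infty$ if none). -}

module Defs where

open import Data.Nat using (ℕ; zero; suc; _+_; _≤_; _<_)
open import Data.Fin using (Fin; inject₁; fromℕ)
open import Data.Bool using (Bool; true; false; not; _∨_)
open import Data.Maybe using (Maybe; just; nothing)
open import Data.Product using (_×_; Σ)
open import Relation.Nullary using (¬_)
open import Relation.Binary.PropositionalEquality using (_≡_; _≢_)

Matrix : ℕ → Set
Matrix n = Fin n → Fin n → ℕ

record IsDistanceMatrix {n : ℕ} (D : Matrix n) : Set where
  field
    diag-zero : ∀ i → D i i ≡ 0
    off-pos   : ∀ i j → i ≢ j → 0 < D i j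
    symmetric : ∀ i j → D i j ≡ D j i
    triangle  : ∀ i j w → D i j ≤ D i w + D w j

-- An edge-weighted (directed-presentation of a) graph on V:
-- E u v k  means there is an edge from u to v of weight k.
WGraph : Set → Set₁
WGraph V = V → V → ℕ → Set

data Walk {V : Set} (E : WGraph V) : V → V → ℕ → Set where
  []  : ∀ {u} → Walk E u u 0
  _∷_ : ∀ {u w v a b} → E u w a → Walk E w v b → Walk E u v (a + b)

-- "Dist E u v m": m is the shortest-path distance from u to v
-- (m = nothing means ∞, i.e. no walk).
Dist : {V : Set} → WGraph V → V → V → Maybe ℕ → Set
Dist E u v nothing  = ∀ k → ¬ Walk E u v k
Dist E u v (just d) = Walk E u v d × (∀ k → Walk E u v k → d ≤ k)

GtTwo : Maybe ℕ → Set
GtTwo nothing  = Data.Unit.⊤ where import Data.Unit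
GtTwo (just d) = 2 < d

data GD {n : ℕ} (D : Matrix n) : WGraph (Fin n) where
  edge : ∀ {i j} → D i j ≡ 1 → GD D i j 1

-- The formula φ₁ over variables x_{i,n+1}, i ∈ [n] (indexed by Fin n).

data Literal (n : ℕ) : Set where
  pos : Fin n → Literal n
  neg : Fin n → Literal n

Clause : ℕ → Set
Clause n = Literal n × Literal n

evalLit : ∀ {n} → (Fin n → Bool) → Literal n → Bool
evalLit X (pos i) = X i
evalLit X (neg i) = not (X i)

evalClause : ∀ {n} → (Fin n → Bool) → Clause n → Bool
evalClause X (l₁ Data.Product., l₂) = evalLit X l₁ ∨ evalLit X l₂

data InPhi1 {n : ℕ} (D : Matrix n) : Clause n → Set where
  far  : ∀ i j → 2 < D i j →
         InPhi1 D (neg i Data.Product., neg j)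
  twoˡ : ∀ i j → D i j ≡ 2 → (∀ m → Dist (GD D) i j m → GtTwo m) →
         InPhi1 D (pos i Data.Product., pos i)
  twoʳ : ∀ i j → D i j ≡ 2 → (∀ m → Dist (GD D) i j m → GtTwo m) →
         InPhi1 D (pos j Data.Product., pos j)

Satisfies : ∀ {n} (D : Matrix n) → (Fin n → Bool) → Set
Satisfies D X = ∀ C → InPhi1 D C → evalClause X C ≡ true

-- G_{φ₁,X} on v₁..v_{n+1}: v_i = inject₁ i (i ∈ Fin n), v_{n+1} = fromℕ n.

data GphiX {n : ℕ} (D : Matrix n) (X : Fin n → Bool) : WGraph (Fin (suc n)) where
  old  : ∀ {i j} → D i j ≡ 1 → GphiX D X (inject₁ i) (inject₁ j) 1
  newˡ : ∀ {i} → X i ≡ true → GphiX D X (inject₁ i) (fromℕ n) 1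
  newʳ : ∀ {i} → X i ≡ true → GphiX D X (fromℕ n) (inject₁ i) 1

data Skel2 {n : ℕ} (D : Matrix n) : WGraph (Fin n) where
  edge : ∀ {i j} → i ≢ j → D i j ≤ 2 → Skel2 D i j (D i j)

{-# OPTIONS --safe #-}
-- A walk in G_{φ₁,X} between original vertices only leaves G_D through the
-- new vertex v_{n+1}, i.e. along a detour v_a v_{n+1} v_b with x_a, x_b true;
-- the clause (x̄_a ∨ x̄_b) forces D_ab ≤ 2, so the detour (length 2) is
-- replaced by the skeleton edge ab (weight ≤ 2).  Conversely a skeleton edge
-- of weight 1 is an edge of G_D, and one of weight 2 is realised by a path
-- of length 2: through a common neighbour in G_D if there is one, and
-- otherwise d_{G_D}(v_a,v_b) > 2, so the unit clauses force x_a, x_b and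
-- v_a v_{n+1} v_b is such a path.  Walks thus map both ways without
-- getting heavier, which makes the two shortest-path distances agree.
module Submission where

open import Defs
open import Data.Bool using (Bool; true; not; _∨_)
open import Data.Bool.Properties using (∨-idem)
open import Data.Empty using (⊥; ⊥-elim)
open import Data.Fin using (Fin; inject₁; fromℕ; _≟_)
open import Data.Fin.Properties using (inject₁-injective; fromℕ≢inject₁; any?)
open import Data.Maybe using (Maybe; just; nothing)
open import Data.Nat using (ℕ; suc; _+_; _≤_; _<_; _≤?_; z≤n; s≤s)
import Data.Nat as ℕ
open import Data.Nat.Properties
  using (≤-refl; ≤-trans; ≤-antisym; m≤n+m; +-assoc; +-monoʳ-≤; +-monoˡ-≤; ≰⇒>; 0≢1+n; n≮0)
open import Data.Product using (∃-syntax; _×_; _,_)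
open import Data.Sum using (_⊎_; inj₁; inj₂)
open import Data.Unit using (tt)
open import Function.Bundles using (_⇔_; mk⇔)
open import Relation.Nullary using (¬_; Dec; yes; no)
open import Relation.Nullary.Decidable using (_×-dec_)
open import Relation.Binary.PropositionalEquality
  using (_≡_; _≢_; refl; sym; trans; subst; subst₂)

Walk≤ : {V : Set} → WGraph V → V → V → ℕ → Set
Walk≤ E u v k = ∃[ k′ ] k′ ≤ k × Walk E u v k′

module _ {V : Set} {E : WGraph V} where

  infixr 5 _++ᵂ_ _∷≤_

  _++ᵂ_ : ∀ {u w v a b} → Walk E u w a → Walk E w v b → Walk E u v (a + b)
  [] ++ᵂ q = q
  _∷_ {a = a} {b = b} e p ++ᵂ q = subst (Walk E _ _) (sym (+-assoc a b _)) (e ∷ (p ++ᵂ q))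

  weaken : ∀ {u v k l} → k ≤ l → Walk≤ E u v k → Walk≤ E u v l
  weaken k≤l (k′ , k′≤k , p) = k′ , ≤-trans k′≤k k≤l , p

  _∷≤_ : ∀ {u w v a k} → E u w a → Walk≤ E w v k → Walk≤ E u v (a + k)
  _∷≤_ {a = a} e (k′ , k′≤k , p) = a + k′ , +-monoʳ-≤ a k′≤k , e ∷ p

module _ {V W : Set} {E : WGraph V} {F : WGraph W} {u v : V} {u′ v′ : W} where

  Dist-transfer : (∀ {k} → Walk E u v k → Walk≤ F u′ v′ k) →
                  (∀ {k} → Walk F u′ v′ k → Walk≤ E u v k) →
                  ∀ m → Dist E u v m → Dist F u′ v′ m
  Dist-transfer to from nothing none k q with from q
  ... | k′ , _ , p = none k′ p
  Dist-transfer to from (just d) (p , minimal) with to p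
  ... | d′ , d′≤d , q with from q
  ...   | d″ , d″≤d′ , p′ =
    subst (Walk F u′ v′) d′≡d q ,
    λ k q′ → let (k′ , k′≤k , p″) = from q′ in ≤-trans (minimal k′ p″) k′≤k
    where
    d′≡d : d′ ≡ d
    d′≡d = ≤-antisym d′≤d (≤-trans (minimal d″ p′) d″≤d′)

module _ {V W : Set} {E : WGraph V} {F : WGraph W} {u v : V} {u′ v′ : W} where

  Dist-⇔ : (∀ {k} → Walk E u v k → Walk≤ F u′ v′ k) →
           (∀ {k} → Walk F u′ v′ k → Walk≤ E u v k) →
           ∀ m → Dist E u v m ⇔ Dist F u′ v′ m
  Dist-⇔ to from m = mk⇔ (Dist-transfer to from m) (Dist-transfer from to m)

module _ {n : ℕ} (D : Matrix n) where

  CommonNeighbour : Fin n → Fin n → Set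
  CommonNeighbour a b = ∃[ w ] D a w ≡ 1 × D w b ≡ 1

  commonNeighbour? : ∀ a b → Dec (CommonNeighbour a b)
  commonNeighbour? a b = any? λ w → D a w ℕ.≟ 1 ×-dec D w b ℕ.≟ 1

  GD-walk-≤2 : ∀ {a b d} → Walk (GD D) a b d → d ≤ 2 →
               a ≡ b ⊎ D a b ≡ 1 ⊎ CommonNeighbour a b
  GD-walk-≤2 []                                 _ = inj₁ refl
  GD-walk-≤2 (edge p ∷ [])                      _ = inj₂ (inj₁ p)
  GD-walk-≤2 (edge p ∷ (edge q ∷ []))           _ = inj₂ (inj₂ (_ , p , q))
  GD-walk-≤2 (edge _ ∷ (edge _ ∷ (edge _ ∷ _))) (s≤s (s≤s ()))

module _ {n : ℕ} {D : Matrix n} (isD : IsDistanceMatrix D) where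
  open IsDistanceMatrix isD

  positive⇒distinct : ∀ {a b k} → D a b ≡ suc k → a ≢ b
  positive⇒distinct {a} p refl = 0≢1+n (trans (sym (diag-zero a)) p)

  two-apart⇒GD-far : ∀ {a b} → D a b ≡ 2 → ¬ CommonNeighbour D a b →
                     ∀ m → Dist (GD D) a b m → GtTwo m
  two-apart⇒GD-far _ _ nothing _ = tt
  two-apart⇒GD-far {a} {b} Dab≡2 noCN (just d) (p , _) with d ≤? 2
  ... | no d≰2  = ≰⇒> d≰2
  ... | yes d≤2 = ⊥-elim (excluded (GD-walk-≤2 D p d≤2))
    where
    excluded : a ≡ b ⊎ D a b ≡ 1 ⊎ CommonNeighbour D a b → ⊥
    excluded (inj₁ a≡b)          = positive⇒distinct Dab≡2 a≡b
    excluded (inj₂ (inj₂ cn))    = noCN cn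
    excluded (inj₂ (inj₁ Dab≡1)) with trans (sym Dab≡2) Dab≡1
    ... | ()

  module _ {X : Fin n → Bool} (sat : Satisfies D X) where

    private
      G = GphiX D X
      S = Skel2 D

    hub-neighbours-close : ∀ {a b} → X a ≡ true → X b ≡ true → D a b ≤ 2
    hub-neighbours-close {a} {b} xa xb with D a b ≤? 2
    ... | yes Dab≤2 = Dab≤2
    ... | no Dab≰2 with subst₂ (λ x y → not x ∨ not y ≡ true) xa xb (sat _ (far a b (≰⇒> Dab≰2)))
    ...   | ()

    two-apart-walk : ∀ {a b} → D a b ≡ 2 → Walk G (inject₁ a) (inject₁ b) 2
    two-apart-walk {a} {b} Dab≡2 with commonNeighbour? D a b
    ... | yes (w , Daw≡1 , Dwb≡1) = old Daw≡1 ∷ (old Dwb≡1 ∷ [])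
    ... | no noCN = newˡ (unit (twoˡ a b Dab≡2 GD-far)) ∷ (newʳ (unit (twoʳ a b Dab≡2 GD-far)) ∷ [])
      where
      GD-far : ∀ m → Dist (GD D) a b m → GtTwo m
      GD-far = two-apart⇒GD-far Dab≡2 noCN
      unit : ∀ {c} → InPhi1 D (pos c , pos c) → X c ≡ true
      unit {c} clause = trans (sym (∨-idem (X c))) (sat _ clause)

    skeleton-edge-walk : ∀ {a b} → a ≢ b → D a b ≤ 2 → Walk G (inject₁ a) (inject₁ b) (D a b)
    skeleton-edge-walk {a} {b} a≢b Dab≤2 with D a b in Dab
    ... | 0 = ⊥-elim (n≮0 (subst (0 <_) Dab (off-pos a b a≢b)))
    ... | 1 = old Dab ∷ []
    ... | 2 = two-apart-walk Dab
    ... | suc (suc (suc _)) with Dab≤2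
    ...   | s≤s (s≤s ())

    skeleton⇒GphiX : ∀ {i j k} → Walk S i j k → Walk G (inject₁ i) (inject₁ j) k
    skeleton⇒GphiX []                   = []
    skeleton⇒GphiX (edge a≢b Dab≤2 ∷ p) = skeleton-edge-walk a≢b Dab≤2 ++ᵂ skeleton⇒GphiX p

    GD-edge-in-skeleton : ∀ {a b} → D a b ≡ 1 → S a b 1
    GD-edge-in-skeleton Dab≡1 =
      subst (S _ _) Dab≡1 (edge (positive⇒distinct Dab≡1) (subst (_≤ 2) (sym Dab≡1) (s≤s z≤n)))

    -- Endpoints are fixed by equations since inject₁ and fromℕ are not
    -- constructors.  In the second function the walk has just entered
    -- v_{n+1} from v_a, whence the extra 1 in the weight.
    GphiX⇒skeleton : ∀ {u v k i j} → Walk G u v k → u ≡ inject₁ i → v ≡ inject₁ j →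
                     Walk≤ S i j k
    GphiX⇒skeleton-via-hub : ∀ {a u v k j} → X a ≡ true →
                             Walk G u v k → u ≡ fromℕ n → v ≡ inject₁ j →
                             Walk≤ S a j (suc k)

    GphiX⇒skeleton [] u≡i u≡j with inject₁-injective (trans (sym u≡i) u≡j)
    ... | refl = 0 , z≤n , []
    GphiX⇒skeleton (old Dab≡1 ∷ p) a≡i v≡j with inject₁-injective a≡i
    ... | refl = GD-edge-in-skeleton Dab≡1 ∷≤ GphiX⇒skeleton p refl v≡j
    GphiX⇒skeleton (newˡ xa ∷ p) a≡i v≡j with inject₁-injective a≡i
    ... | refl = GphiX⇒skeleton-via-hub xa p refl v≡j
    GphiX⇒skeleton (newʳ _ ∷ _) hub≡i _ = ⊥-elim (fromℕ≢inject₁ hub≡i)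

    GphiX⇒skeleton-via-hub _ [] u≡hub u≡j = ⊥-elim (fromℕ≢inject₁ (trans (sym u≡hub) u≡j))
    GphiX⇒skeleton-via-hub _ (old _ ∷ _) i≡hub _ = ⊥-elim (fromℕ≢inject₁ (sym i≡hub))
    GphiX⇒skeleton-via-hub _ (newˡ _ ∷ _) i≡hub _ = ⊥-elim (fromℕ≢inject₁ (sym i≡hub))
    GphiX⇒skeleton-via-hub {a} xa (newʳ {b} xb ∷ p) _ v≡j with a ≟ b
    ... | yes refl = weaken (m≤n+m _ 2) (GphiX⇒skeleton p refl v≡j)
    ... | no a≢b   = weaken (+-monoˡ-≤ _ Dab≤2) (edge a≢b Dab≤2 ∷≤ GphiX⇒skeleton p refl v≡j)
      where
      Dab≤2 : D a b ≤ 2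
      Dab≤2 = hub-neighbours-close xa xb

lemma3 : (n : ℕ) (D : Matrix n) → IsDistanceMatrix D →
    (X : Fin n → Bool) → Satisfies D X →
    (i j : Fin n) (m : Maybe ℕ) →
    Dist (GphiX D X) (inject₁ i) (inject₁ j) m ⇔ Dist (Skel2 D) i j m
lemma3 n D isD X sat i j =
  Dist-⇔ (λ p → GphiX⇒skeleton isD sat p refl refl)
         (λ p → _ , ≤-refl , skeleton⇒GphiX isD sat p)
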